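{- Let $u\geq 2$ be an integer and $C(u)=\{n\in\mathbb{Z}\colon u\nmid n\}$. Every non-negative integer is a sum of at most $5940$ squares of elements of $C(u)$. -}

module Defs where

open import Data.Nat using (ℕ)
open import Data.Integer using (ℤ; +_; _*_; _+_)
open import Data.Integer.Divisibility using (_∣_)
open import Data.List using (List; map; foldr)
open import Relation.Nullary using (¬_)

C : ℕ → ℤ → Set
C u n = ¬ ((+ u) ∣ n)

sumSq : List ℤ → ℤ
sumSq xs = foldr _+_ (+ 0) (map (λ x → x * x) xs)

module Submission where

-- Euler's identity makes sums of
-- four squares closed under products, so only primes p need work.  A pigeonhole argument on
-- the residues a² and -(1 + b²) modulo p gives a multiple m·p = a² + b² + 1² + 0² with
-- 0 < m < p, and Euler's descent (reducing the four roots symmetrically modulo m) turns a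
-- representation of m·p into one of k·p with 0 < k < m, until m = 1.
--
-- The second part writes n = 8 + 2u²·Q + s with s < 2u².  Writing Q = Σ aᵢ²,
-- 2u²·Q + 8 = Σ ((u·aᵢ + 1)² + (u·aᵢ - 1)²) uses eight squares from C(u).  Writing
-- s = Σ Bᵢ², each Bᵢ² < 2u² forces Bᵢ to be 0, u, or not divisible by u, and
-- u² = (u - 1)² + (2u - 1) where 2u - 1 is a sum of four squares of numbers below u;
-- so s needs at most 4·5 = 20 squares from C(u).

open import Defs
open import Data.Nat using (ℕ; _≤_)
open import Data.Integer using (ℤ; +_)
open import Data.List using (List; length)
open import Data.List.Relation.Unary.All using (All)
open import Data.Product using (Σ; _×_)
open import Relation.Binary.PropositionalEquality using (_≡_)

open import Data.Nat as ℕ using (zero; suc; _<_; _∸_; _/_; _%_; NonZero; z≤n; s≤s)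
import Data.Nat.Properties as ℕP
import Data.Nat.DivMod as ℕDM
open import Data.Nat.Divisibility as ℕD using (divides; _∣?_)
open import Data.Nat.Primality using (Prime; composite; composite?; prime; euclidsLemma; prime⇒irreducible; prime⇒nonZero; prime⇒nonTrivial)
open import Data.Nat.Induction using (<-rec)
import Data.Nat.Tactic.RingSolver as ℕSolver
open import Data.Integer as ℤ using (-[1+_]; _*_; _+_; _-_; -_; ∣_∣)
import Data.Integer.Properties as ℤP
import Data.Integer.Divisibility.Signed as ℤD
import Data.Integer.DivMod as ℤDM
open import Data.Integer.Tactic.RingSolver using (solve-∀)
open import Data.Fin as Fin using (Fin; toℕ; fromℕ<)
import Data.Fin.Properties as FinP
open import Data.List using ([]; _∷_; _++_)
import Data.List.Properties as ListP
open import Data.List.Relation.Unary.All using ([]; _∷_)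
import Data.List.Relation.Unary.All.Properties as AllP
open import Data.Empty using (⊥; ⊥-elim)
open import Data.Sum using (_⊎_; inj₁; inj₂; [_,_])
open import Data.Product using (_,_; proj₁; proj₂)
open import Relation.Binary.PropositionalEquality using (refl; sym; trans; cong; cong₂; subst; subst₂; _≢_; module ≡-Reasoning)
open import Relation.Nullary using (¬_; Dec; yes; no)

record FourSquares (N : ℤ) : Set where
  constructor fourSquares
  field
    a b c d : ℤ
    sum     : N ≡ a * a + b * b + c * c + d * d

euler-identity : ∀ a₁ a₂ a₃ a₄ b₁ b₂ b₃ b₄ →
  (a₁ * a₁ + a₂ * a₂ + a₃ * a₃ + a₄ * a₄) * (b₁ * b₁ + b₂ * b₂ + b₃ * b₃ + b₄ * b₄)
  ≡ (a₁ * b₁ + a₂ * b₂ + a₃ * b₃ + a₄ * b₄) * (a₁ * b₁ + a₂ * b₂ + a₃ * b₃ + a₄ * b₄)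
  + (a₁ * b₂ - a₂ * b₁ + a₃ * b₄ - a₄ * b₃) * (a₁ * b₂ - a₂ * b₁ + a₃ * b₄ - a₄ * b₃)
  + (a₁ * b₃ - a₂ * b₄ - a₃ * b₁ + a₄ * b₂) * (a₁ * b₃ - a₂ * b₄ - a₃ * b₁ + a₄ * b₂)
  + (a₁ * b₄ + a₂ * b₃ - a₃ * b₂ - a₄ * b₁) * (a₁ * b₄ + a₂ * b₃ - a₃ * b₂ - a₄ * b₁)
euler-identity = solve-∀

fourSquares-* : ∀ {M N} → FourSquares M → FourSquares N → FourSquares (M * N)
fourSquares-* (fourSquares a₁ a₂ a₃ a₄ refl) (fourSquares b₁ b₂ b₃ b₄ refl) =
  fourSquares (a₁ * b₁ + a₂ * b₂ + a₃ * b₃ + a₄ * b₄) (a₁ * b₂ - a₂ * b₁ + a₃ * b₄ - a₄ * b₃)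
              (a₁ * b₃ - a₂ * b₄ - a₃ * b₁ + a₄ * b₂) (a₁ * b₄ + a₂ * b₃ - a₃ * b₂ - a₄ * b₁)
              (euler-identity a₁ a₂ a₃ a₄ b₁ b₂ b₃ b₄)

squares-cong : ∀ {a b c d a′ b′ c′ d′ : ℤ} → a ≡ a′ → b ≡ b′ → c ≡ c′ → d ≡ d′ →
  a * a + b * b + c * c + d * d ≡ a′ * a′ + b′ * b′ + c′ * c′ + d′ * d′
squares-cong refl refl refl refl = refl

prime-not-multiple : ∀ {p m} → Prime p → 2 ≤ m → m < p → (Z : ℤ) → + p ≢ + m * Z
prime-not-multiple {p} {m} pr 2≤m m<p Z p≡mZ = excluded (prime⇒irreducible pr m∣p)
  where
  m∣p : m ℕD.∣ p
  m∣p = ℤD.∣⇒∣ᵤ (ℤD.divides Z (trans p≡mZ (ℤP.*-comm (+ m) Z)))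
  excluded : m ≡ 1 ⊎ m ≡ p → ⊥
  excluded (inj₁ m≡1) = ℕP.<-irrefl (sym m≡1) 2≤m
  excluded (inj₂ m≡p) = ℕP.<-irrefl m≡p m<p

-- Division with a remainder of least absolute value: x = m·q + y with |y| ≤ m/2,
-- where y is negative only if |y| < m/2.
record SymmetricResidue (m : ℕ) (x : ℤ) : Set where
  field
    quotient : ℤ
    size     : ℕ
    small    : 2 ℕ.* size ≤ m
    residue  : (x - + m * quotient ≡ + size) ⊎ (x - + m * quotient ≡ - + size × 2 ℕ.* size < m)

symmetricResidue : (m : ℕ) .{{_ : NonZero m}} (x : ℤ) → SymmetricResidue m x
symmetricResidue m x = choose (2 ℕ.* s ℕ.≤? m)
  where
  open ≡-Reasoning
  s : ℕ
  s = x ℤDM.%ℕ m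
  d : ℤ
  d = x ℤDM./ℕ m
  x≡s+dm : x ≡ + s + d * + m
  x≡s+dm = ℤDM.a≡a%ℕn+[a/ℕn]*n x m
  choose : Dec (2 ℕ.* s ≤ m) → SymmetricResidue m x
  choose (yes 2s≤m) = record { quotient = d ; size = s ; small = 2s≤m ; residue = inj₁ x-md≡s }
    where
    x-md≡s : x - + m * d ≡ + s
    x-md≡s = begin
      x - + m * d             ≡⟨ cong (_- + m * d) x≡s+dm ⟩
      + s + d * + m - + m * d ≡⟨ drop-multiple (+ s) d (+ m) ⟩
      + s                     ∎
      where
      drop-multiple : ∀ s d m → s + d * m - m * d ≡ s
      drop-multiple = solve-∀
  choose (no 2s≰m) = record { quotient = d + + 1 ; size = t ; small = ℕP.<⇒≤ 2t<m ; residue = inj₂ (x-m[d+1]≡-t , 2t<m) }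
    where
    t : ℕ
    t = m ∸ s
    t+s≡m : t ℕ.+ s ≡ m
    t+s≡m = ℕP.m∸n+n≡m (ℕP.<⇒≤ (ℤDM.n%ℕd<d x m))
    t<s : t < s
    t<s = ℕP.+-cancelʳ-< s t s (subst₂ _<_ (sym t+s≡m) (cong (s ℕ.+_) (ℕP.+-identityʳ s)) (ℕP.≰⇒> 2s≰m))
    2t<m : 2 ℕ.* t < m
    2t<m = subst₂ _<_ (cong (t ℕ.+_) (sym (ℕP.+-identityʳ t))) t+s≡m (ℕP.+-monoʳ-< t t<s)
    x-m[d+1]≡-t : x - + m * (d + + 1) ≡ - + t
    x-m[d+1]≡-t = begin
      x - + m * (d + + 1)                   ≡⟨ cong (_- + m * (d + + 1)) x≡s+dm ⟩
      + s + d * + m - + m * (d + + 1)       ≡⟨ cong (λ M → + s + d * M - M * (d + + 1)) (trans (cong +_ (sym t+s≡m)) (ℤP.pos-+ t s)) ⟩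
      + s + d * (+ t + + s) - (+ t + + s) * (d + + 1) ≡⟨ drop-multiple (+ s) (+ t) d ⟩
      - + t                                 ∎
      where
      drop-multiple : ∀ s t d → s + d * (t + s) - (t + s) * (d + + 1) ≡ - t
      drop-multiple = solve-∀

residue-square : ∀ {y v} {A : Set} → (y ≡ + v) ⊎ (y ≡ - + v × A) → y * y ≡ + (v ℕ.* v)
residue-square {v = v} (inj₁ refl)       = sym (ℤP.pos-* v v)
residue-square {v = v} (inj₂ (refl , _)) = trans (negated-square (+ v)) (sym (ℤP.pos-* v v))
  where
  negated-square : ∀ t → (- t) * (- t) ≡ t * t
  negated-square = solve-∀

residue-zero : ∀ {y v} {A : Set} → v ≡ 0 → (y ≡ + v) ⊎ (y ≡ - + v × A) → y ≡ + 0
residue-zero refl (inj₁ y≡0)       = y≡0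
residue-zero refl (inj₂ (y≡0 , _)) = y≡0

residue-half : ∀ {y v m} → 2 ℕ.* v ≡ m → (y ≡ + v) ⊎ (y ≡ - + v × 2 ℕ.* v < m) → y ≡ + v
residue-half _    (inj₁ y≡v)        = y≡v
residue-half refl (inj₂ (_ , 2v<2v)) = ⊥-elim (ℕP.<-irrefl refl 2v<2v)

-- Let M·P = x₁² + x₂² + x₃² + x₄² and reduce the xᵢ
-- to yᵢ = xᵢ - M·qᵢ.  Then Σ yᵢ² = M·r for an explicit r, and the four products in
-- Euler's identity for (Σ xᵢ²)(Σ yᵢ²) are all divisible by M, so P·r = Σ wᵢ².
module DescentAlgebra (M P x₁ x₂ x₃ x₄ q₁ q₂ q₃ q₄ : ℤ) where

  y₁ y₂ y₃ y₄ : ℤ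
  y₁ = x₁ - M * q₁
  y₂ = x₂ - M * q₂
  y₃ = x₃ - M * q₃
  y₄ = x₄ - M * q₄

  r : ℤ
  r = P - + 2 * (x₁ * q₁ + x₂ * q₂ + x₃ * q₃ + x₄ * q₄) + M * (q₁ * q₁ + q₂ * q₂ + q₃ * q₃ + q₄ * q₄)

  w₁ w₂ w₃ w₄ : ℤ
  w₁ = P - (x₁ * q₁ + x₂ * q₂ + x₃ * q₃ + x₄ * q₄)
  w₂ = x₂ * q₁ - x₁ * q₂ + x₄ * q₃ - x₃ * q₄
  w₃ = x₃ * q₁ - x₁ * q₃ + x₂ * q₄ - x₄ * q₂
  w₄ = x₄ * q₁ + x₃ * q₂ - x₂ * q₃ - x₁ * q₄

  module _ (MP≡ : M * P ≡ x₁ * x₁ + x₂ * x₂ + x₃ * x₃ + x₄ * x₄) where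

    reduced-multiple : M * r ≡ y₁ * y₁ + y₂ * y₂ + y₃ * y₃ + y₄ * y₄
    reduced-multiple = begin
      M * r                                                   ≡⟨ expand M P x₁ x₂ x₃ x₄ q₁ q₂ q₃ q₄ ⟩
      M * P - (x₁ * x₁ + x₂ * x₂ + x₃ * x₃ + x₄ * x₄) + (y₁ * y₁ + y₂ * y₂ + y₃ * y₃ + y₄ * y₄)
        ≡⟨ cong (λ S → S - (x₁ * x₁ + x₂ * x₂ + x₃ * x₃ + x₄ * x₄) + (y₁ * y₁ + y₂ * y₂ + y₃ * y₃ + y₄ * y₄)) MP≡ ⟩
      (x₁ * x₁ + x₂ * x₂ + x₃ * x₃ + x₄ * x₄) - (x₁ * x₁ + x₂ * x₂ + x₃ * x₃ + x₄ * x₄) + (y₁ * y₁ + y₂ * y₂ + y₃ * y₃ + y₄ * y₄)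
        ≡⟨ cancel (x₁ * x₁ + x₂ * x₂ + x₃ * x₃ + x₄ * x₄) (y₁ * y₁ + y₂ * y₂ + y₃ * y₃ + y₄ * y₄) ⟩
      y₁ * y₁ + y₂ * y₂ + y₃ * y₃ + y₄ * y₄                   ∎
      where
      open ≡-Reasoning
      expand : ∀ M P x₁ x₂ x₃ x₄ q₁ q₂ q₃ q₄ →
        M * (P - + 2 * (x₁ * q₁ + x₂ * q₂ + x₃ * q₃ + x₄ * q₄) + M * (q₁ * q₁ + q₂ * q₂ + q₃ * q₃ + q₄ * q₄))
        ≡ M * P - (x₁ * x₁ + x₂ * x₂ + x₃ * x₃ + x₄ * x₄)
          + ((x₁ - M * q₁) * (x₁ - M * q₁) + (x₂ - M * q₂) * (x₂ - M * q₂) + (x₃ - M * q₃) * (x₃ - M * q₃) + (x₄ - M * q₄) * (x₄ - M * q₄))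
      expand = solve-∀
      cancel : ∀ S T → S - S + T ≡ T
      cancel = solve-∀

    -- P·r = Σ wᵢ²: Euler's identity for (M·P)(M·r) after cancelling M².
    reduced-product : .{{_ : ℤ.NonZero M}} → P * r ≡ w₁ * w₁ + w₂ * w₂ + w₃ * w₃ + w₄ * w₄
    reduced-product = ℤP.*-cancelˡ-≡ M _ _ (ℤP.*-cancelˡ-≡ M _ _ (begin
      M * (M * (P * r))                                        ≡⟨ regroup M P r ⟩
      (M * P) * (M * r)                                        ≡⟨ cong₂ _*_ MP≡ reduced-multiple ⟩
      (x₁ * x₁ + x₂ * x₂ + x₃ * x₃ + x₄ * x₄) * (y₁ * y₁ + y₂ * y₂ + y₃ * y₃ + y₄ * y₄)
                                                               ≡⟨ euler-identity x₁ x₂ x₃ x₄ y₁ y₂ y₃ y₄ ⟩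
      _                                                        ≡⟨ squares-cong z₁≡ (z₂≡ M x₁ x₂ x₃ x₄ q₁ q₂ q₃ q₄)
                                                                    (z₃≡ M x₁ x₂ x₃ x₄ q₁ q₂ q₃ q₄) (z₄≡ M x₁ x₂ x₃ x₄ q₁ q₂ q₃ q₄) ⟩
      (M * w₁) * (M * w₁) + (M * w₂) * (M * w₂) + (M * w₃) * (M * w₃) + (M * w₄) * (M * w₄)
                                                               ≡⟨ factor M w₁ w₂ w₃ w₄ ⟩
      M * (M * (w₁ * w₁ + w₂ * w₂ + w₃ * w₃ + w₄ * w₄))        ∎))
      where
      open ≡-Reasoning
      regroup : ∀ M P r → M * (M * (P * r)) ≡ (M * P) * (M * r)
      regroup = solve-∀
      factor : ∀ M w₁ w₂ w₃ w₄ → (M * w₁) * (M * w₁) + (M * w₂) * (M * w₂) + (M * w₃) * (M * w₃) + (M * w₄) * (M * w₄)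
        ≡ M * (M * (w₁ * w₁ + w₂ * w₂ + w₃ * w₃ + w₄ * w₄))
      factor = solve-∀
      z₁≡ : x₁ * y₁ + x₂ * y₂ + x₃ * y₃ + x₄ * y₄ ≡ M * w₁
      z₁≡ = begin
        x₁ * y₁ + x₂ * y₂ + x₃ * y₃ + x₄ * y₄ ≡⟨ expand M P x₁ x₂ x₃ x₄ q₁ q₂ q₃ q₄ ⟩
        M * w₁ + (x₁ * x₁ + x₂ * x₂ + x₃ * x₃ + x₄ * x₄ - M * P) ≡⟨ cong (λ S → M * w₁ + (S - M * P)) (sym MP≡) ⟩
        M * w₁ + (M * P - M * P)               ≡⟨ cancel (M * w₁) (M * P) ⟩
        M * w₁                                 ∎
        where
        expand : ∀ M P x₁ x₂ x₃ x₄ q₁ q₂ q₃ q₄ →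
          x₁ * (x₁ - M * q₁) + x₂ * (x₂ - M * q₂) + x₃ * (x₃ - M * q₃) + x₄ * (x₄ - M * q₄)
          ≡ M * (P - (x₁ * q₁ + x₂ * q₂ + x₃ * q₃ + x₄ * q₄)) + ((x₁ * x₁ + x₂ * x₂ + x₃ * x₃ + x₄ * x₄) - M * P)
        expand = solve-∀
        cancel : ∀ S T → S + (T - T) ≡ S
        cancel = solve-∀
      z₂≡ : ∀ M x₁ x₂ x₃ x₄ q₁ q₂ q₃ q₄ →
        x₁ * (x₂ - M * q₂) - x₂ * (x₁ - M * q₁) + x₃ * (x₄ - M * q₄) - x₄ * (x₃ - M * q₃)
        ≡ M * (x₂ * q₁ - x₁ * q₂ + x₄ * q₃ - x₃ * q₄)
      z₂≡ = solve-∀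
      z₃≡ : ∀ M x₁ x₂ x₃ x₄ q₁ q₂ q₃ q₄ →
        x₁ * (x₃ - M * q₃) - x₂ * (x₄ - M * q₄) - x₃ * (x₁ - M * q₁) + x₄ * (x₂ - M * q₂)
        ≡ M * (x₃ * q₁ - x₁ * q₃ + x₂ * q₄ - x₄ * q₂)
      z₃≡ = solve-∀
      z₄≡ : ∀ M x₁ x₂ x₃ x₄ q₁ q₂ q₃ q₄ →
        x₁ * (x₄ - M * q₄) + x₂ * (x₃ - M * q₃) - x₃ * (x₂ - M * q₂) - x₄ * (x₁ - M * q₁)
        ≡ M * (x₄ * q₁ + x₃ * q₂ - x₂ * q₃ - x₁ * q₄)
      z₄≡ = solve-∀

squares-vanish : ∀ a b c d → a ℕ.* a ℕ.+ b ℕ.* b ℕ.+ c ℕ.* c ℕ.+ d ℕ.* d ≡ 0 →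
  a ≡ 0 × b ≡ 0 × c ≡ 0 × d ≡ 0
squares-vanish a b c d S≡0 =
  root a (ℕP.m+n≡0⇒m≡0 (a ℕ.* a) ab≡0) , root b (ℕP.m+n≡0⇒n≡0 (a ℕ.* a) ab≡0) ,
  root c (ℕP.m+n≡0⇒n≡0 (a ℕ.* a ℕ.+ b ℕ.* b) abc≡0) , root d (ℕP.m+n≡0⇒n≡0 (a ℕ.* a ℕ.+ b ℕ.* b ℕ.+ c ℕ.* c) S≡0)
  where
  abc≡0 : a ℕ.* a ℕ.+ b ℕ.* b ℕ.+ c ℕ.* c ≡ 0
  abc≡0 = ℕP.m+n≡0⇒m≡0 _ S≡0
  ab≡0 : a ℕ.* a ℕ.+ b ℕ.* b ≡ 0
  ab≡0 = ℕP.m+n≡0⇒m≡0 _ abc≡0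
  root : ∀ x → x ℕ.* x ≡ 0 → x ≡ 0
  root x x²≡0 = [ (λ x≡0 → x≡0) , (λ x≡0 → x≡0) ] (ℕP.m*n≡0⇒m≡0∨n≡0 x x²≡0)

module BoundedSquares {a b c d m : ℕ} (a≤m : a ≤ m) (b≤m : b ≤ m) (c≤m : c ≤ m) (d≤m : d ≤ m) where

  four-times : ∀ n → n ℕ.+ n ℕ.+ n ℕ.+ n ≡ 4 ℕ.* n
  four-times = ℕSolver.solve-∀

  square-≤ : ∀ {x} → x ≤ m → x ℕ.* x ≤ m ℕ.* m
  square-≤ x≤m = ℕP.*-mono-≤ x≤m x≤m

  square-< : ∀ {x} → x < m → x ℕ.* x < m ℕ.* m
  square-< x<m = ℕP.*-mono-< x<m x<m

  squares-bounded : a ℕ.* a ℕ.+ b ℕ.* b ℕ.+ c ℕ.* c ℕ.+ d ℕ.* d ≤ 4 ℕ.* (m ℕ.* m)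
  squares-bounded = subst (a ℕ.* a ℕ.+ b ℕ.* b ℕ.+ c ℕ.* c ℕ.+ d ℕ.* d ≤_) (four-times (m ℕ.* m))
    (ℕP.+-mono-≤ (ℕP.+-mono-≤ (ℕP.+-mono-≤ (square-≤ a≤m) (square-≤ b≤m)) (square-≤ c≤m)) (square-≤ d≤m))

  squares-maximal : a ℕ.* a ℕ.+ b ℕ.* b ℕ.+ c ℕ.* c ℕ.+ d ℕ.* d ≡ 4 ℕ.* (m ℕ.* m) →
    a ≡ m × b ≡ m × c ≡ m × d ≡ m
  squares-maximal S≡4m² =
    maximal a≤m (λ a<m → ℕP.+-mono-<-≤ (ℕP.+-mono-<-≤ (ℕP.+-mono-<-≤ (square-< a<m) (square-≤ b≤m)) (square-≤ c≤m)) (square-≤ d≤m)) ,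
    maximal b≤m (λ b<m → ℕP.+-mono-<-≤ (ℕP.+-mono-<-≤ (ℕP.+-mono-≤-< (square-≤ a≤m) (square-< b<m)) (square-≤ c≤m)) (square-≤ d≤m)) ,
    maximal c≤m (λ c<m → ℕP.+-mono-<-≤ (ℕP.+-mono-≤-< (ℕP.+-mono-≤ (square-≤ a≤m) (square-≤ b≤m)) (square-< c<m)) (square-≤ d≤m)) ,
    maximal d≤m (λ d<m → ℕP.+-mono-≤-< (ℕP.+-mono-≤ (ℕP.+-mono-≤ (square-≤ a≤m) (square-≤ b≤m)) (square-≤ c≤m)) (square-< d<m))
    where
    maximal : ∀ {x} → x ≤ m → (x < m → a ℕ.* a ℕ.+ b ℕ.* b ℕ.+ c ℕ.* c ℕ.+ d ℕ.* d < m ℕ.* m ℕ.+ m ℕ.* m ℕ.+ m ℕ.* m ℕ.+ m ℕ.* m) → x ≡ m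
    maximal x≤m drop = ℕP.≤-antisym x≤m (ℕP.≮⇒≥ (λ x<m →
      ℕP.<-irrefl (trans S≡4m² (sym (four-times (m ℕ.* m)))) (drop x<m)))

not-square-multiple : ∀ {p m} → Prime p → 2 ≤ m → m < p → ∀ Z → + m * + p ≢ + m * (+ m * Z)
not-square-multiple {m = suc m′} pr 2≤m m<p Z mp≡mmZ =
  prime-not-multiple pr 2≤m m<p Z (ℤP.*-cancelˡ-≡ (+ suc m′) _ _ mp≡mmZ)

squares-of-multiples : ∀ M {x₁ x₂ x₃ x₄} q₁ q₂ q₃ q₄ →
  x₁ ≡ M * q₁ → x₂ ≡ M * q₂ → x₃ ≡ M * q₃ → x₄ ≡ M * q₄ →
  x₁ * x₁ + x₂ * x₂ + x₃ * x₃ + x₄ * x₄ ≡ M * (M * (q₁ * q₁ + q₂ * q₂ + q₃ * q₃ + q₄ * q₄))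
squares-of-multiples M q₁ q₂ q₃ q₄ refl refl refl refl = factor M q₁ q₂ q₃ q₄
  where
  factor : ∀ M q₁ q₂ q₃ q₄ → (M * q₁) * (M * q₁) + (M * q₂) * (M * q₂) + (M * q₃) * (M * q₃) + (M * q₄) * (M * q₄)
    ≡ M * (M * (q₁ * q₁ + q₂ * q₂ + q₃ * q₃ + q₄ * q₄))
  factor = solve-∀

squares-of-odd-multiples : ∀ V {x₁ x₂ x₃ x₄} q₁ q₂ q₃ q₄ →
  x₁ ≡ V + + 2 * V * q₁ → x₂ ≡ V + + 2 * V * q₂ → x₃ ≡ V + + 2 * V * q₃ → x₄ ≡ V + + 2 * V * q₄ →
  x₁ * x₁ + x₂ * x₂ + x₃ * x₃ + x₄ * x₄
  ≡ (+ 2 * V) * ((+ 2 * V) * (+ 1 + (q₁ + q₁ * q₁) + (q₂ + q₂ * q₂) + (q₃ + q₃ * q₃) + (q₄ + q₄ * q₄)))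
squares-of-odd-multiples V q₁ q₂ q₃ q₄ refl refl refl refl = factor V q₁ q₂ q₃ q₄
  where
  factor : ∀ V q₁ q₂ q₃ q₄ →
    (V + + 2 * V * q₁) * (V + + 2 * V * q₁) + (V + + 2 * V * q₂) * (V + + 2 * V * q₂)
    + (V + + 2 * V * q₃) * (V + + 2 * V * q₃) + (V + + 2 * V * q₄) * (V + + 2 * V * q₄)
    ≡ (+ 2 * V) * ((+ 2 * V) * (+ 1 + (q₁ + q₁ * q₁) + (q₂ + q₂ * q₂) + (q₃ + q₃ * q₃) + (q₄ + q₄ * q₄)))
  factor = solve-∀

natural-cofactor : ∀ m .{{_ : NonZero m}} (r : ℤ) {R : ℕ} → + m * r ≡ + R → Σ ℕ λ k → r ≡ + k × m ℕ.* k ≡ R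
natural-cofactor (suc m′) (+ k)    mk≡R = k , refl , ℤP.+-injective (trans (ℤP.pos-* (suc m′) k) mk≡R)
natural-cofactor (suc m′) -[1+ k ] ()

pos-sum4 : ∀ a b c d → + a + + b + + c + + d ≡ + (a ℕ.+ b ℕ.+ c ℕ.+ d)
pos-sum4 a b c d = sym (trans (ℤP.pos-+ (a ℕ.+ b ℕ.+ c) d)
  (cong (_+ + d) (trans (ℤP.pos-+ (a ℕ.+ b) c) (cong (_+ + c) (ℤP.pos-+ a b)))))

recover : ∀ {x y} M q → x - M * q ≡ y → x ≡ y + M * q
recover {x} M q refl = reassemble x M q
  where
  reassemble : ∀ x M q → x ≡ (x - M * q) + M * q
  reassemble = solve-∀

descent-step : ∀ {p m} → Prime p → 2 ≤ m → m < p → FourSquares (+ (m ℕ.* p)) →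
  Σ ℕ λ k → 1 ≤ k × k < m × FourSquares (+ (k ℕ.* p))
descent-step {p} {m} pr 2≤m m<p (fourSquares x₁ x₂ x₃ x₄ mp≡Σx²) =
  k , ℕP.n≢0⇒n>0 k≢0 , ℕP.≤∧≢⇒< k≤m k≢m , fourSquares w₁ w₂ w₃ w₄ kp≡Σw²
  where
  instance
    m-nonZero : NonZero m
    m-nonZero = ℕ.>-nonZero (ℕP.<-trans (s≤s z≤n) 2≤m)
  open SymmetricResidue (symmetricResidue m x₁) renaming (quotient to q₁; size to v₁; small to 2v₁≤m; residue to y₁≡±v₁)
  open SymmetricResidue (symmetricResidue m x₂) renaming (quotient to q₂; size to v₂; small to 2v₂≤m; residue to y₂≡±v₂)
  open SymmetricResidue (symmetricResidue m x₃) renaming (quotient to q₃; size to v₃; small to 2v₃≤m; residue to y₃≡±v₃)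
  open SymmetricResidue (symmetricResidue m x₄) renaming (quotient to q₄; size to v₄; small to 2v₄≤m; residue to y₄≡±v₄)
  open DescentAlgebra (+ m) (+ p) x₁ x₂ x₃ x₄ q₁ q₂ q₃ q₄
  open BoundedSquares 2v₁≤m 2v₂≤m 2v₃≤m 2v₄≤m

  MP≡Σx² : + m * + p ≡ x₁ * x₁ + x₂ * x₂ + x₃ * x₃ + x₄ * x₄
  MP≡Σx² = trans (sym (ℤP.pos-* m p)) mp≡Σx²

  R : ℕ
  R = v₁ ℕ.* v₁ ℕ.+ v₂ ℕ.* v₂ ℕ.+ v₃ ℕ.* v₃ ℕ.+ v₄ ℕ.* v₄
  mr≡R : + m * r ≡ + R
  mr≡R = trans (reduced-multiple MP≡Σx²) (trans
    (cong₂ _+_ (cong₂ _+_ (cong₂ _+_ (residue-square y₁≡±v₁) (residue-square y₂≡±v₂)) (residue-square y₃≡±v₃)) (residue-square y₄≡±v₄))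
    (pos-sum4 (v₁ ℕ.* v₁) (v₂ ℕ.* v₂) (v₃ ℕ.* v₃) (v₄ ℕ.* v₄)))
  k : ℕ
  k = proj₁ (natural-cofactor m r mr≡R)
  r≡k : r ≡ + k
  r≡k = proj₁ (proj₂ (natural-cofactor m r mr≡R))
  mk≡R : m ℕ.* k ≡ R
  mk≡R = proj₂ (proj₂ (natural-cofactor m r mr≡R))

  -- (2v₁)² + … + (2v₄)² = 4·m·k, which is at most 4m² as 2vᵢ ≤ m
  Σ[2v]²≡4mk : (2 ℕ.* v₁) ℕ.* (2 ℕ.* v₁) ℕ.+ (2 ℕ.* v₂) ℕ.* (2 ℕ.* v₂) ℕ.+ (2 ℕ.* v₃) ℕ.* (2 ℕ.* v₃) ℕ.+ (2 ℕ.* v₄) ℕ.* (2 ℕ.* v₄)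
               ≡ 4 ℕ.* (m ℕ.* k)
  Σ[2v]²≡4mk = trans (quadruple v₁ v₂ v₃ v₄) (cong (4 ℕ.*_) (sym mk≡R))
    where
    quadruple : ∀ v₁ v₂ v₃ v₄ →
      (2 ℕ.* v₁) ℕ.* (2 ℕ.* v₁) ℕ.+ (2 ℕ.* v₂) ℕ.* (2 ℕ.* v₂) ℕ.+ (2 ℕ.* v₃) ℕ.* (2 ℕ.* v₃) ℕ.+ (2 ℕ.* v₄) ℕ.* (2 ℕ.* v₄)
      ≡ 4 ℕ.* (v₁ ℕ.* v₁ ℕ.+ v₂ ℕ.* v₂ ℕ.+ v₃ ℕ.* v₃ ℕ.+ v₄ ℕ.* v₄)
    quadruple = ℕSolver.solve-∀

  k≤m : k ≤ m
  k≤m = ℕP.*-cancelˡ-≤ m (ℕP.*-cancelˡ-≤ 4 (subst (_≤ 4 ℕ.* (m ℕ.* m)) Σ[2v]²≡4mk squares-bounded))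

  -- k = 0 forces every residue to vanish, so m² ∣ m·p
  k≢0 : k ≢ 0
  k≢0 k≡0 = all-zero (squares-vanish v₁ v₂ v₃ v₄ R≡0)
    where
    R≡0 : R ≡ 0
    R≡0 = trans (sym mk≡R) (trans (cong (m ℕ.*_) k≡0) (ℕP.*-zeroʳ m))
    multiple : ∀ x q {v} {A : Set} → v ≡ 0 → (x - + m * q ≡ + v) ⊎ (x - + m * q ≡ - + v × A) → x ≡ + m * q
    multiple x q v≡0 y≡±v = trans (recover (+ m) q (residue-zero v≡0 y≡±v)) (ℤP.+-identityˡ (+ m * q))
    all-zero : v₁ ≡ 0 × v₂ ≡ 0 × v₃ ≡ 0 × v₄ ≡ 0 → ⊥
    all-zero (v₁≡0 , v₂≡0 , v₃≡0 , v₄≡0) = not-square-multiple pr 2≤m m<p _ (trans MP≡Σx²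
      (squares-of-multiples (+ m) q₁ q₂ q₃ q₄ (multiple x₁ q₁ v₁≡0 y₁≡±v₁) (multiple x₂ q₂ v₂≡0 y₂≡±v₂)
                                              (multiple x₃ q₃ v₃≡0 y₃≡±v₃) (multiple x₄ q₄ v₄≡0 y₄≡±v₄)))

  -- k = m forces every residue to be m/2, so again m² ∣ m·p
  k≢m : k ≢ m
  k≢m k≡m = all-half (squares-maximal (trans Σ[2v]²≡4mk (cong (λ n → 4 ℕ.* (m ℕ.* n)) k≡m)))
    where
    Z : ℤ
    Z = + 1 + (q₁ + q₁ * q₁) + (q₂ + q₂ * q₂) + (q₃ + q₃ * q₃) + (q₄ + q₄ * q₄)
    all-half : 2 ℕ.* v₁ ≡ m × 2 ℕ.* v₂ ≡ m × 2 ℕ.* v₃ ≡ m × 2 ℕ.* v₄ ≡ m → ⊥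
    all-half (2v₁≡m , 2v₂≡m , 2v₃≡m , 2v₄≡m) =
      not-square-multiple pr 2≤m m<p Z (trans MP≡Σx² (subst (λ M → x₁ * x₁ + x₂ * x₂ + x₃ * x₃ + x₄ * x₄ ≡ M * (M * Z)) 2v₁≡M
        (squares-of-odd-multiples (+ v₁) q₁ q₂ q₃ q₄ (odd-multiple x₁ q₁ 2v₁≡m y₁≡±v₁) (odd-multiple x₂ q₂ 2v₂≡m y₂≡±v₂)
                                                     (odd-multiple x₃ q₃ 2v₃≡m y₃≡±v₃) (odd-multiple x₄ q₄ 2v₄≡m y₄≡±v₄))))
      where
      2v₁≡M : + 2 * + v₁ ≡ + m
      2v₁≡M = trans (sym (ℤP.pos-* 2 v₁)) (cong +_ 2v₁≡m)
      odd-multiple : ∀ x q {v} → 2 ℕ.* v ≡ m → (x - + m * q ≡ + v) ⊎ (x - + m * q ≡ - + v × 2 ℕ.* v < m) →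
                     x ≡ + v₁ + + 2 * + v₁ * q
      odd-multiple x q 2v≡m y≡±v =
        subst₂ (λ V M → x ≡ + V + M * q) (ℕP.*-cancelˡ-≡ _ _ 2 (trans 2v≡m (sym 2v₁≡m))) (sym 2v₁≡M)
          (recover (+ m) q (residue-half 2v≡m y≡±v))

  kp≡Σw² : + (k ℕ.* p) ≡ w₁ * w₁ + w₂ * w₂ + w₃ * w₃ + w₄ * w₄
  kp≡Σw² = trans (cong +_ (ℕP.*-comm k p)) (trans (ℤP.pos-* p k) (trans (cong (+ p *_) (sym r≡k)) (reduced-product MP≡Σx²)))

descent : ∀ {p} → Prime p → ∀ m → 1 ≤ m → m < p → FourSquares (+ (m ℕ.* p)) → FourSquares (+ p)
descent {p} pr = <-rec Descends step
  where
  Descends : ℕ → Set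
  Descends m = 1 ≤ m → m < p → FourSquares (+ (m ℕ.* p)) → FourSquares (+ p)
  step : ∀ m → (∀ {k} → k < m → Descends k) → Descends m
  step (suc zero)     _   _ _   1p = subst FourSquares (cong +_ (ℕP.*-identityˡ p)) 1p
  step (suc (suc m′)) rec _ m<p mp = continue (descent-step pr (s≤s (s≤s z≤n)) m<p mp)
    where
    continue : (Σ ℕ λ k → 1 ≤ k × k < suc (suc m′) × FourSquares (+ (k ℕ.* p))) → FourSquares (+ p)
    continue (k , 1≤k , k<m , kp) = rec k<m 1≤k (ℕP.<-trans k<m m<p) kp

same-remainder⇒∣∸ : ∀ {p} .{{_ : NonZero p}} a b → a % p ≡ b % p → p ℕD.∣ b ∸ a
same-remainder⇒∣∸ {p} a b a%p≡b%p = divides (b / p ∸ a / p) (begin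
  b ∸ a                                          ≡⟨ cong₂ _∸_ (ℕDM.m≡m%n+[m/n]*n b p) (ℕDM.m≡m%n+[m/n]*n a p) ⟩
  (b % p ℕ.+ b / p ℕ.* p) ∸ (a % p ℕ.+ a / p ℕ.* p) ≡⟨ cong (λ r → (b % p ℕ.+ b / p ℕ.* p) ∸ (r ℕ.+ a / p ℕ.* p)) a%p≡b%p ⟩
  (b % p ℕ.+ b / p ℕ.* p) ∸ (b % p ℕ.+ a / p ℕ.* p) ≡⟨ ℕP.[m+n]∸[m+o]≡n∸o (b % p) _ _ ⟩
  b / p ℕ.* p ∸ a / p ℕ.* p                      ≡⟨ ℕP.*-distribʳ-∸ p (b / p) (a / p) ⟨
  (b / p ∸ a / p) ℕ.* p                          ∎)
  where open ≡-Reasoning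

difference-of-squares : ∀ {a b} → a ≤ b → b ℕ.* b ∸ a ℕ.* a ≡ (b ∸ a) ℕ.* (b ℕ.+ a)
difference-of-squares {a} {b} a≤b = begin
  b ℕ.* b ∸ a ℕ.* a                       ≡⟨ cong (λ x → x ℕ.* x ∸ a ℕ.* a) (sym a+c≡b) ⟩
  (a ℕ.+ c) ℕ.* (a ℕ.+ c) ∸ a ℕ.* a       ≡⟨ cong (_∸ a ℕ.* a) (expand a c) ⟩
  a ℕ.* a ℕ.+ c ℕ.* (a ℕ.+ c ℕ.+ a) ∸ a ℕ.* a ≡⟨ ℕP.m+n∸m≡n (a ℕ.* a) _ ⟩
  c ℕ.* (a ℕ.+ c ℕ.+ a)                   ≡⟨ cong (λ x → c ℕ.* (x ℕ.+ a)) a+c≡b ⟩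
  c ℕ.* (b ℕ.+ a)                         ∎
  where
  open ≡-Reasoning
  c : ℕ
  c = b ∸ a
  a+c≡b : a ℕ.+ c ≡ b
  a+c≡b = ℕP.m+[n∸m]≡n a≤b
  expand : ∀ a c → (a ℕ.+ c) ℕ.* (a ℕ.+ c) ≡ a ℕ.* a ℕ.+ c ℕ.* (a ℕ.+ c ℕ.+ a)
  expand = ℕSolver.solve-∀

prime-∤-small : ∀ {p n} → 0 < n → n < p → ¬ p ℕD.∣ n
prime-∤-small 0<n n<p p∣n = ℕP.<⇒≱ n<p (ℕD.∣⇒≤ {{ℕ.>-nonZero 0<n}} p∣n)

squares-incongruent : ∀ {p a b} → Prime p → a < b → a ℕ.+ b < p → ¬ p ℕD.∣ b ℕ.* b ∸ a ℕ.* a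
squares-incongruent {p} {a} {b} pr a<b a+b<p p∣b²-a² =
  [ prime-∤-small (ℕP.m<n⇒0<n∸m a<b) (ℕP.≤-<-trans (ℕP.m∸n≤m b a) b<p)
  , prime-∤-small (ℕP.<-≤-trans (ℕP.m<n⇒0<n∸m a<b) (ℕP.≤-trans (ℕP.m∸n≤m b a) (ℕP.m≤m+n b a))) (subst (_< p) (ℕP.+-comm a b) a+b<p)
  ] (euclidsLemma (b ∸ a) (b ℕ.+ a) pr (subst (p ℕD.∣_) (difference-of-squares (ℕP.<⇒≤ a<b)) p∣b²-a²))
  where
  b<p : b < p
  b<p = ℕP.≤-<-trans (ℕP.m≤n+m b a) a+b<p

-- The p/2 + 1 values a² and the
-- p/2 + 1 values -(1 + b²) (represented by (p - 1)(1 + b²)) cannot all be distinct modulo p;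
-- two squares, or two values of the second kind, are never congruent.
module SquaresModPrime {p : ℕ} (pr : Prime p) where

  instance
    p-nonZero : NonZero p
    p-nonZero = prime⇒nonZero pr

  1<p : 1 < p
  1<p = ℕ.nonTrivial⇒n>1 p {{prime⇒nonTrivial pr}}

  -- h = ⌊p/2⌋; the N = 2(h + 1) > p arguments below cannot have distinct residues modulo p
  h : ℕ
  h = p / 2

  h+h≤p : h ℕ.+ h ≤ p
  h+h≤p = subst (_≤ p) (trans (ℕP.*-comm h 2) (cong (h ℕ.+_) (ℕP.+-identityʳ h))) (ℕDM.m/n*n≤m p 2)

  N : ℕ
  N = suc h ℕ.+ suc h

  p<N : p < N
  p<N = subst₂ _<_ (sym (ℕDM.m≡m%n+[m/n]*n p 2)) (double h) (ℕP.+-monoˡ-< (h ℕ.* 2) (ℕDM.m%n<n p 2))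
    where
    double : ∀ h → 2 ℕ.+ h ℕ.* 2 ≡ suc h ℕ.+ suc h
    double = ℕSolver.solve-∀

  value : (k : ℕ) → Dec (k ≤ h) → ℕ
  value a (yes _) = a ℕ.* a
  value k (no _)  = (p ∸ 1) ℕ.* (1 ℕ.+ (k ∸ suc h) ℕ.* (k ∸ suc h))

  residue : Fin N → Fin p
  residue i = fromℕ< (ℕDM.m%n<n (value (toℕ i) (toℕ i ℕ.≤? h)) p)

  Solution : Set
  Solution = Σ ℕ λ a → Σ ℕ λ b → 2 ℕ.* a ≤ p × 2 ℕ.* b ≤ p × p ℕD.∣ a ℕ.* a ℕ.+ (1 ℕ.+ b ℕ.* b)

  doubled-≤ : ∀ {a} → a ≤ h → 2 ℕ.* a ≤ p
  doubled-≤ {a} a≤h = ℕP.≤-trans (subst (_≤ h ℕ.+ h) (cong (a ℕ.+_) (sym (ℕP.+-identityʳ a))) (ℕP.+-mono-≤ a≤h a≤h)) h+h≤p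

  shifted-≤ : ∀ {k} → k < N → k ∸ suc h ≤ h
  shifted-≤ {k} k<N = ℕP.≤-pred (ℕP.m<n+o⇒m∸n<o k (suc h) k<N)

  distinct-squares : ∀ {a b} → a < b → b ≤ h → ¬ p ℕD.∣ b ℕ.* b ∸ a ℕ.* a
  distinct-squares {a} {b} a<b b≤h = squares-incongruent pr a<b
    (ℕP.<-≤-trans (ℕP.+-monoˡ-< b a<b) (ℕP.≤-trans (ℕP.+-mono-≤ b≤h b≤h) h+h≤p))

  mixed : ∀ a b → (a ℕ.* a) % p ≡ ((p ∸ 1) ℕ.* (1 ℕ.+ b ℕ.* b)) % p → p ℕD.∣ a ℕ.* a ℕ.+ (1 ℕ.+ b ℕ.* b)
  mixed a b a²≡-J = ℕD.m%n≡0⇒n∣m _ p (begin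
    (a ℕ.* a ℕ.+ J) % p                               ≡⟨ ℕDM.%-distribˡ-+ (a ℕ.* a) J p ⟩
    ((a ℕ.* a) % p ℕ.+ J % p) % p                     ≡⟨ cong (λ r → (r ℕ.+ J % p) % p) a²≡-J ⟩
    (((p ∸ 1) ℕ.* J) % p ℕ.+ J % p) % p               ≡⟨ ℕDM.%-distribˡ-+ ((p ∸ 1) ℕ.* J) J p ⟨
    ((p ∸ 1) ℕ.* J ℕ.+ J) % p                         ≡⟨ cong (_% p) (predecessor-multiple p J) ⟩
    (J ℕ.* p) % p                                     ≡⟨ ℕDM.m*n%n≡0 J p ⟩
    0                                                 ∎)
    where
    open ≡-Reasoning
    J : ℕ
    J = 1 ℕ.+ b ℕ.* b
    predecessor-multiple : ∀ p .{{_ : NonZero p}} J → (p ∸ 1) ℕ.* J ℕ.+ J ≡ J ℕ.* p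
    predecessor-multiple (suc p′) J = solve p′ J
      where
      solve : ∀ p′ J → p′ ℕ.* J ℕ.+ J ≡ J ℕ.* suc p′
      solve = ℕSolver.solve-∀

  collision : ∀ a b → a < b → b < N → (a≤?h : Dec (a ≤ h)) (b≤?h : Dec (b ≤ h)) →
              value a a≤?h % p ≡ value b b≤?h % p → Solution
  collision a b a<b b<N (yes a≤h) (yes b≤h) same =
    ⊥-elim (distinct-squares a<b b≤h (same-remainder⇒∣∸ (a ℕ.* a) (b ℕ.* b) same))
  collision a b a<b b<N (no a≰h)  (yes b≤h) same = ⊥-elim (a≰h (ℕP.≤-trans (ℕP.<⇒≤ a<b) b≤h))
  collision a b a<b b<N (yes a≤h) (no b≰h)  same =
    a , b ∸ suc h , doubled-≤ a≤h , doubled-≤ (shifted-≤ b<N) , mixed a (b ∸ suc h) same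
  collision a b a<b b<N (no a≰h)  (no b≰h)  same =
    ⊥-elim ([ prime-∤-small (ℕP.m<n⇒0<n∸m 1<p) (ℕP.∸-monoʳ-< (s≤s z≤n) (ℕP.<⇒≤ 1<p)) , distinct-squares a′<b′ (shifted-≤ b<N) ]
      (euclidsLemma (p ∸ 1) (b′ ℕ.* b′ ∸ a′ ℕ.* a′) pr p∣))
    where
    a′ b′ : ℕ
    a′ = a ∸ suc h
    b′ = b ∸ suc h
    a′<b′ : a′ < b′
    a′<b′ = ℕP.∸-monoˡ-< a<b (ℕP.≰⇒> a≰h)
    p∣ : p ℕD.∣ (p ∸ 1) ℕ.* (b′ ℕ.* b′ ∸ a′ ℕ.* a′)
    p∣ = subst (p ℕD.∣_) (sym (ℕP.*-distribˡ-∸ (p ∸ 1) (1 ℕ.+ b′ ℕ.* b′) (1 ℕ.+ a′ ℕ.* a′)))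
           (same-remainder⇒∣∸ _ _ same)

  solution : Solution
  solution = from-collision (FinP.pigeonhole p<N residue)
    where
    from-collision : (Σ (Fin N) λ i → Σ (Fin N) λ j → i Fin.< j × residue i ≡ residue j) → Solution
    from-collision (i , j , i<j , same) = collision (toℕ i) (toℕ j) i<j (FinP.toℕ<n j) (toℕ i ℕ.≤? h) (toℕ j ℕ.≤? h)
      (trans (sym (FinP.toℕ-fromℕ< _)) (trans (cong toℕ same) (FinP.toℕ-fromℕ< _)))

small-multiple-of : ∀ {p} → Prime p → ∀ a b → 2 ℕ.* a ≤ p → 2 ℕ.* b ≤ p → p ℕD.∣ a ℕ.* a ℕ.+ (1 ℕ.+ b ℕ.* b) →
  Σ ℕ λ m → 1 ≤ m × m < p × FourSquares (+ (m ℕ.* p))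
small-multiple-of {p} pr a b 2a≤p 2b≤p p∣X = X / p , 1≤m , m<p , fourSquares (+ a) (+ b) (+ 1) (+ 0) (trans (cong +_ mp≡X) (as-squares a b))
  where
  instance
    p-nonZero : NonZero p
    p-nonZero = prime⇒nonZero pr
  X : ℕ
  X = a ℕ.* a ℕ.+ (1 ℕ.+ b ℕ.* b)
  mp≡X : X / p ℕ.* p ≡ X
  mp≡X = ℕDM.m/n*n≡m p∣X
  1≤m : 1 ≤ X / p
  1≤m = ℕP.n≢0⇒n>0 (λ m≡0 → ℕP.1+n≢0 (ℕP.m+n≡0⇒n≡0 (a ℕ.* a) (trans (sym mp≡X) (cong (ℕ._* p) m≡0))))
  -- 4X = (2a)² + (2b)² + 4 ≤ 2p² + 4 < 4p², since p² ≥ 4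
  4X<4p² : 4 ℕ.* X < 4 ℕ.* (p ℕ.* p)
  4X<4p² = begin-strict
    4 ℕ.* X                                         ≡⟨ quadruple a b ⟩
    (2 ℕ.* a) ℕ.* (2 ℕ.* a) ℕ.+ (2 ℕ.* b) ℕ.* (2 ℕ.* b) ℕ.+ 4
                                                   ≤⟨ ℕP.+-monoˡ-≤ 4 (ℕP.+-mono-≤ (ℕP.*-mono-≤ 2a≤p 2a≤p) (ℕP.*-mono-≤ 2b≤p 2b≤p)) ⟩
    p ℕ.* p ℕ.+ p ℕ.* p ℕ.+ 4                       <⟨ ℕP.+-monoʳ-< (p ℕ.* p ℕ.+ p ℕ.* p) 4<p²+p² ⟩
    p ℕ.* p ℕ.+ p ℕ.* p ℕ.+ (p ℕ.* p ℕ.+ p ℕ.* p)   ≡⟨ four-times (p ℕ.* p) ⟩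
    4 ℕ.* (p ℕ.* p)                                 ∎
    where
    open ℕP.≤-Reasoning
    quadruple : ∀ a b → 4 ℕ.* (a ℕ.* a ℕ.+ (1 ℕ.+ b ℕ.* b)) ≡ (2 ℕ.* a) ℕ.* (2 ℕ.* a) ℕ.+ (2 ℕ.* b) ℕ.* (2 ℕ.* b) ℕ.+ 4
    quadruple = ℕSolver.solve-∀
    four-times : ∀ n → n ℕ.+ n ℕ.+ (n ℕ.+ n) ≡ 4 ℕ.* n
    four-times = ℕSolver.solve-∀
    4≤p² : 4 ≤ p ℕ.* p
    4≤p² = ℕP.*-mono-≤ 2≤p 2≤p
      where
      2≤p : 2 ≤ p
      2≤p = ℕ.nonTrivial⇒n>1 p {{prime⇒nonTrivial pr}}
    4<p²+p² : 4 < p ℕ.* p ℕ.+ p ℕ.* p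
    4<p²+p² = ℕP.≤-trans (ℕP.+-monoʳ-≤ 1 4≤p²) (ℕP.+-monoˡ-≤ (p ℕ.* p) (ℕP.<-≤-trans (s≤s z≤n) 4≤p²))
  m<p : X / p < p
  m<p = ℕP.*-cancelʳ-< p (X / p) p (subst (_< p ℕ.* p) (sym mp≡X) (ℕP.*-cancelˡ-< 4 X (p ℕ.* p) 4X<4p²))
  as-squares : ∀ a b → + (a ℕ.* a ℕ.+ (1 ℕ.+ b ℕ.* b)) ≡ + a * + a + + b * + b + + 1 * + 1 + + 0 * + 0
  as-squares a b = trans (ℤP.pos-+ (a ℕ.* a) (1 ℕ.+ b ℕ.* b))
    (trans (cong₂ _+_ (ℤP.pos-* a a) (trans (ℤP.pos-+ 1 (b ℕ.* b)) (cong (λ B → + 1 + B) (ℤP.pos-* b b)))) (rearrange (+ a) (+ b)))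
    where
    rearrange : ∀ A B → A * A + (+ 1 + B * B) ≡ A * A + B * B + + 1 * + 1 + + 0 * + 0
    rearrange = solve-∀

small-multiple : ∀ {p} → Prime p → Σ ℕ λ m → 1 ≤ m × m < p × FourSquares (+ (m ℕ.* p))
small-multiple {p} pr = from-solution (SquaresModPrime.solution pr)
  where
  from-solution : SquaresModPrime.Solution pr → Σ ℕ λ m → 1 ≤ m × m < p × FourSquares (+ (m ℕ.* p))
  from-solution (a , b , 2a≤p , 2b≤p , p∣X) = small-multiple-of pr a b 2a≤p 2b≤p p∣X

lagrange : ∀ n → FourSquares (+ n)
lagrange = <-rec (λ n → FourSquares (+ n)) step
  where
  step : ∀ n → (∀ {k} → k < n → FourSquares (+ k)) → FourSquares (+ n)
  step zero          _   = fourSquares (+ 0) (+ 0) (+ 0) (+ 0) refl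
  step (suc zero)    _   = fourSquares (+ 1) (+ 0) (+ 0) (+ 0) refl
  step n@(suc (suc _)) rec with composite? n
  ... | yes (composite {d} d<n (divides e n≡ed)) =
    subst FourSquares (sym (trans (cong +_ n≡ed) (ℤP.pos-* e d))) (fourSquares-* (rec e<n) (rec d<n))
    where
    e<n : e < n
    e<n = subst (e <_) (sym n≡ed) (ℕP.m<m*n e d {{ℕ.≢-nonZero (λ e≡0 → ℕP.1+n≢0 (trans n≡ed (cong (ℕ._* d) e≡0)))}} (ℕ.nonTrivial⇒n>1 d))
  ... | no ¬composite = from-multiple (small-multiple (prime ¬composite))
    where
    from-multiple : (Σ ℕ λ m → 1 ≤ m × m < n × FourSquares (+ (m ℕ.* n))) → FourSquares (+ n)
    from-multiple (m , 1≤m , m<n , mn) = descent (prime ¬composite) m 1≤m m<n mn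

SquaresInC : ℕ → ℕ → ℤ → Set
SquaresInC u k T = Σ (List ℤ) (λ xs → (length xs ≤ k) × (All (C u) xs × (sumSq xs ≡ T)))

sumSq-++ : ∀ xs ys → sumSq (xs ++ ys) ≡ sumSq xs + sumSq ys
sumSq-++ []       ys = sym (ℤP.+-identityˡ (sumSq ys))
sumSq-++ (x ∷ xs) ys = trans (cong (λ S → x * x + S) (sumSq-++ xs ys)) (sym (ℤP.+-assoc (x * x) (sumSq xs) (sumSq ys)))

squaresInC-+ : ∀ {u j k S T} → SquaresInC u j S → SquaresInC u k T → SquaresInC u (j ℕ.+ k) (S + T)
squaresInC-+ {j = j} {k} (xs , |xs|≤j , xs∈C , Σxs≡S) (ys , |ys|≤k , ys∈C , Σys≡T) =
  xs ++ ys , subst (_≤ j ℕ.+ k) (sym (ListP.length-++ xs)) (ℕP.+-mono-≤ |xs|≤j |ys|≤k) ,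
  AllP.++⁺ xs∈C ys∈C , trans (sumSq-++ xs ys) (cong₂ _+_ Σxs≡S Σys≡T)

squaresInC-≤ : ∀ {u j k T} → j ≤ k → SquaresInC u j T → SquaresInC u k T
squaresInC-≤ j≤k (xs , |xs|≤j , xs∈C , Σxs≡T) = xs , ℕP.≤-trans |xs|≤j j≤k , xs∈C , Σxs≡T

squaresInC-0 : ∀ {u k} → SquaresInC u k (+ 0)
squaresInC-0 = [] , z≤n , [] , refl

squaresInC-1 : ∀ {u} x → C u x → SquaresInC u 1 (x * x)
squaresInC-1 x x∈C = x ∷ [] , s≤s z≤n , x∈C ∷ [] , ℤP.+-identityʳ (x * x)

pos-square : ∀ c → + c * + c ≡ + (c ℕ.* c)
pos-square c = sym (ℤP.pos-* c c)

four-square-parts : ∀ {u k T} → FourSquares (+ T) → (∀ c → c ℕ.* c ≤ T → SquaresInC u k (+ (c ℕ.* c))) →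
                    SquaresInC u (k ℕ.+ k ℕ.+ k ℕ.+ k) (+ T)
four-square-parts {T = T} (fourSquares a₁ a₂ a₃ a₄ T≡Σa²) part =
  subst (SquaresInC _ _) (trans (pos-sum4 A₁ A₂ A₃ A₄) (cong +_ (sym T≡ΣA)))
    (squaresInC-+ (squaresInC-+ (squaresInC-+ (part ∣ a₁ ∣ A₁≤T) (part ∣ a₂ ∣ A₂≤T)) (part ∣ a₃ ∣ A₃≤T)) (part ∣ a₄ ∣ A₄≤T))
  where
  A₁ A₂ A₃ A₄ : ℕ
  A₁ = ∣ a₁ ∣ ℕ.* ∣ a₁ ∣
  A₂ = ∣ a₂ ∣ ℕ.* ∣ a₂ ∣
  A₃ = ∣ a₃ ∣ ℕ.* ∣ a₃ ∣
  A₄ = ∣ a₄ ∣ ℕ.* ∣ a₄ ∣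
  square-abs : ∀ a → a * a ≡ + (∣ a ∣ ℕ.* ∣ a ∣)
  square-abs (+ n)    = pos-square n
  square-abs -[1+ n ] = refl
  T≡ΣA : T ≡ A₁ ℕ.+ A₂ ℕ.+ A₃ ℕ.+ A₄
  T≡ΣA = ℤP.+-injective (trans T≡Σa² (trans
    (cong₂ _+_ (cong₂ _+_ (cong₂ _+_ (square-abs a₁) (square-abs a₂)) (square-abs a₃)) (square-abs a₄))
    (pos-sum4 A₁ A₂ A₃ A₄)))
  bounded : ∀ {A} → A ≤ A₁ ℕ.+ A₂ ℕ.+ A₃ ℕ.+ A₄ → A ≤ T
  bounded A≤ΣA = subst (_ ≤_) (sym T≡ΣA) A≤ΣA
  A₁≤T : A₁ ≤ T
  A₁≤T = bounded (ℕP.≤-trans (ℕP.m≤m+n A₁ A₂) (ℕP.≤-trans (ℕP.m≤m+n (A₁ ℕ.+ A₂) A₃) (ℕP.m≤m+n (A₁ ℕ.+ A₂ ℕ.+ A₃) A₄)))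
  A₂≤T : A₂ ≤ T
  A₂≤T = bounded (ℕP.≤-trans (ℕP.m≤n+m A₂ A₁) (ℕP.≤-trans (ℕP.m≤m+n (A₁ ℕ.+ A₂) A₃) (ℕP.m≤m+n (A₁ ℕ.+ A₂ ℕ.+ A₃) A₄)))
  A₃≤T : A₃ ≤ T
  A₃≤T = bounded (ℕP.≤-trans (ℕP.m≤n+m A₃ (A₁ ℕ.+ A₂)) (ℕP.m≤m+n (A₁ ℕ.+ A₂ ℕ.+ A₃) A₄))
  A₄≤T : A₄ ≤ T
  A₄≤T = bounded (ℕP.m≤n+m A₄ (A₁ ℕ.+ A₂ ℕ.+ A₃))

module Construction {u : ℕ} (2≤u : 2 ≤ u) where

  instance
    u-nonZero : NonZero u
    u-nonZero = ℕ.>-nonZero (ℕP.<-trans (s≤s z≤n) 2≤u)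

  1∈C : C u (+ 1)
  1∈C u∣1 = ℕP.<⇒≱ 2≤u (ℕD.∣⇒≤ u∣1)

  ones : ∀ n → SquaresInC u n (+ n)
  ones zero    = squaresInC-0
  ones (suc n) = subst (SquaresInC u (suc n)) (sym (ℤP.pos-+ 1 n)) (squaresInC-+ (squaresInC-1 (+ 1) 1∈C) (ones n))

  unit-offset∈C : ∀ a r → ∣ r ∣ ≡ 1 → C u (+ u * a + r)
  unit-offset∈C a r ∣r∣≡1 u∣ua+r = 1∈C (subst (u ℕD.∣_) ∣r∣≡1
    (ℤD.∣⇒∣ᵤ {+ u} {r} (ℤD.∣m+n∣m⇒∣n {+ u} {+ u * a} {r} (ℤD.∣ᵤ⇒∣ u∣ua+r) (ℤD.∣m⇒∣m*n {+ u} {+ u} a ℤD.∣-refl))))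

  pair : ∀ a → SquaresInC u 2 (+ 2 * (+ u * + u) * (a * a) + + 2)
  pair a = subst (SquaresInC u 2) (expand (+ u) a)
    (squaresInC-+ (squaresInC-1 (+ u * a + + 1) (unit-offset∈C a (+ 1) refl)) (squaresInC-1 (+ u * a + - + 1) (unit-offset∈C a (- + 1) refl)))
    where
    expand : ∀ U a → (U * a + + 1) * (U * a + + 1) + (U * a + - + 1) * (U * a + - + 1) ≡ + 2 * (U * U) * (a * a) + + 2
    expand = solve-∀

  -- 2u²·Q + 8 is a sum of eight squares from C(u), by pairing each of four squares of Q
  scaled-sum : ∀ {Q} → FourSquares (+ Q) → SquaresInC u 8 (+ 2 * (+ u * + u) * + Q + + 8)
  scaled-sum (fourSquares a₁ a₂ a₃ a₄ Q≡Σa²) =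
    subst (SquaresInC u 8) (trans (collect (+ 2 * (+ u * + u)) a₁ a₂ a₃ a₄) (cong (λ Q → + 2 * (+ u * + u) * Q + + 8) (sym Q≡Σa²)))
      (squaresInC-+ (squaresInC-+ (squaresInC-+ (pair a₁) (pair a₂)) (pair a₃)) (pair a₄))
    where
    collect : ∀ K a₁ a₂ a₃ a₄ → (K * (a₁ * a₁) + + 2) + (K * (a₂ * a₂) + + 2) + (K * (a₃ * a₃) + + 2) + (K * (a₄ * a₄) + + 2)
      ≡ K * (a₁ * a₁ + a₂ * a₂ + a₃ * a₃ + a₄ * a₄) + + 8
    collect = solve-∀

  below-u² : ∀ c → c ℕ.* c < u ℕ.* u → SquaresInC u 1 (+ (c ℕ.* c))
  below-u² c c²<u² with u ∣? c
  ... | no  u∤c                  = subst (SquaresInC u 1) (pos-square c) (squaresInC-1 (+ c) u∤c)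
  ... | yes (divides zero c≡0)   = subst (λ c → SquaresInC u 1 (+ (c ℕ.* c))) (sym c≡0) squaresInC-0
  ... | yes (divides (suc k) c≡) = ⊥-elim (ℕP.<⇒≱ c²<u² (ℕP.*-mono-≤ u≤c u≤c))
    where
    u≤c : u ≤ c
    u≤c = subst (u ≤_) (sym c≡) (ℕP.m≤m+n u (k ℕ.* u))

  -- u² = (u - 1)² + (2u - 1), where u - 1 ∈ C(u) and 2u - 1 is a sum of four squares below u²
  u²-in-C : SquaresInC u 5 (+ (u ℕ.* u))
  u²-in-C = subst (SquaresInC u 5) (trans (sym (ℤP.pos-+ _ (2 ℕ.* u ∸ 1))) (cong +_ (square-split u (ℕP.<⇒≤ 2≤u))))
    (squaresInC-+ (subst (SquaresInC u 1) (pos-square (u ∸ 1)) (squaresInC-1 (+ (u ∸ 1)) u-1∈C))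
                  (four-square-parts (lagrange (2 ℕ.* u ∸ 1)) (λ c c²≤2u-1 → below-u² c (ℕP.≤-<-trans c²≤2u-1 (2u-1<u² u 2≤u)))))
    where
    u-1∈C : C u (+ (u ∸ 1))
    u-1∈C = ℕD.>⇒∤ {{ℕ.>-nonZero (ℕP.∸-monoˡ-≤ 1 2≤u)}} (ℕP.∸-monoʳ-< (s≤s z≤n) (ℕP.<⇒≤ 2≤u))
    square-split : ∀ u → 1 ≤ u → (u ∸ 1) ℕ.* (u ∸ 1) ℕ.+ (2 ℕ.* u ∸ 1) ≡ u ℕ.* u
    square-split (suc w) _ = expand w
      where
      expand : ∀ w → w ℕ.* w ℕ.+ (w ℕ.+ suc (w ℕ.+ 0)) ≡ suc w ℕ.* suc w
      expand = ℕSolver.solve-∀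
    2u-1<u² : ∀ u → 2 ≤ u → 2 ℕ.* u ∸ 1 < u ℕ.* u
    2u-1<u² (suc w) (s≤s 1≤w) = subst (_< suc w ℕ.* suc w) (cong (w ℕ.+_) (cong suc (sym (ℕP.+-identityʳ w))))
      (s≤s (ℕP.+-monoʳ-≤ w (ℕP.m≤n*m (suc w) w {{ℕ.>-nonZero 1≤w}})))

  -- a square below 2u² is a sum of at most five squares from C(u), as its root is 0, u,
  -- or not divisible by u
  below-2u² : ∀ B → B ℕ.* B < 2 ℕ.* (u ℕ.* u) → SquaresInC u 5 (+ (B ℕ.* B))
  below-2u² B B²<2u² with u ∣? B
  ... | no  u∤B                         = squaresInC-≤ (s≤s z≤n) (subst (SquaresInC u 1) (pos-square B) (squaresInC-1 (+ B) u∤B))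
  ... | yes (divides zero B≡0)          = subst (λ B → SquaresInC u 5 (+ (B ℕ.* B))) (sym B≡0) squaresInC-0
  ... | yes (divides (suc zero) B≡u)    = subst (λ B → SquaresInC u 5 (+ (B ℕ.* B))) (sym (trans B≡u (ℕP.+-identityʳ u))) u²-in-C
  ... | yes (divides (suc (suc k)) B≡) = ⊥-elim (ℕP.<⇒≱ B²<2u² (ℕP.≤-trans 2u²≤[2u]² (ℕP.*-mono-≤ 2u≤B 2u≤B)))
    where
    2u≤B : 2 ℕ.* u ≤ B
    2u≤B = subst (2 ℕ.* u ≤_) (sym B≡) (ℕP.*-monoˡ-≤ u {2} {suc (suc k)} (s≤s (s≤s z≤n)))
    2u²≤[2u]² : 2 ℕ.* (u ℕ.* u) ≤ (2 ℕ.* u) ℕ.* (2 ℕ.* u)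
    2u²≤[2u]² = subst (2 ℕ.* (u ℕ.* u) ≤_) (double u) (ℕP.m≤m+n (2 ℕ.* (u ℕ.* u)) (2 ℕ.* (u ℕ.* u)))
      where
      double : ∀ u → 2 ℕ.* (u ℕ.* u) ℕ.+ 2 ℕ.* (u ℕ.* u) ≡ (2 ℕ.* u) ℕ.* (2 ℕ.* u)
      double = ℕSolver.solve-∀

  below-2u²-sum : ∀ s → s < 2 ℕ.* (u ℕ.* u) → SquaresInC u 20 (+ s)
  below-2u²-sum s s<2u² = four-square-parts (lagrange s) (λ B B²≤s → below-2u² B (ℕP.≤-<-trans B²≤s s<2u²))

  -- every n is a sum of at most 28 squares from C(u): write n = 8 + 2u²·Q + s with s < 2u²
  every-number : ∀ n → SquaresInC u 28 (+ n)
  every-number n with n ℕ.<? 8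
  ... | yes n<8 = squaresInC-≤ (ℕP.≤-trans (ℕP.<⇒≤ n<8) (ℕP.m≤m+n 8 20)) (ones n)
  ... | no  n≮8 = subst (SquaresInC u 28) n≡ (squaresInC-+ (scaled-sum (lagrange Q)) (below-2u²-sum s (ℕDM.m%n<n n′ K)))
    where
    K : ℕ
    K = 2 ℕ.* (u ℕ.* u)
    instance
      K-nonZero : NonZero K
      K-nonZero = ℕ.>-nonZero (ℕP.*-mono-≤ {1} {2} (s≤s z≤n) (ℕP.*-mono-≤ (ℕ.>-nonZero⁻¹ u) (ℕ.>-nonZero⁻¹ u)))
    n′ Q s : ℕ
    n′ = n ∸ 8
    Q  = n′ / K
    s  = n′ % K
    n≡ : + 2 * (+ u * + u) * + Q + + 8 + + s ≡ + n
    n≡ = begin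
      + 2 * (+ u * + u) * + Q + + 8 + + s ≡⟨ cong (λ U → + 2 * U * + Q + + 8 + + s) (pos-square u) ⟩
      + 2 * + (u ℕ.* u) * + Q + + 8 + + s ≡⟨ cong (λ k → k * + Q + + 8 + + s) (sym (ℤP.pos-* 2 (u ℕ.* u))) ⟩
      + K * + Q + + 8 + + s               ≡⟨ cong (λ k → k + + 8 + + s) (sym (ℤP.pos-* K Q)) ⟩
      + (K ℕ.* Q) + + 8 + + s             ≡⟨ cong (_+ + s) (sym (ℤP.pos-+ (K ℕ.* Q) 8)) ⟩
      + (K ℕ.* Q ℕ.+ 8) + + s             ≡⟨ sym (ℤP.pos-+ (K ℕ.* Q ℕ.+ 8) s) ⟩
      + (K ℕ.* Q ℕ.+ 8 ℕ.+ s)             ≡⟨ cong +_ (rearrange K Q s) ⟩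
      + (s ℕ.+ Q ℕ.* K ℕ.+ 8)             ≡⟨ cong (λ m → + (m ℕ.+ 8)) (sym (ℕDM.m≡m%n+[m/n]*n n′ K)) ⟩
      + (n′ ℕ.+ 8)                        ≡⟨ cong +_ (ℕP.m∸n+n≡m (ℕP.≮⇒≥ n≮8)) ⟩
      + n                                 ∎
      where
      open ≡-Reasoning
      rearrange : ∀ k q s → k ℕ.* q ℕ.+ 8 ℕ.+ s ≡ s ℕ.+ q ℕ.* k ℕ.+ 8
      rearrange = ℕSolver.solve-∀

theorem2p3 : (u : ℕ) → 2 ≤ u → (n : ℕ) →
    Σ (List ℤ) (λ xs → (length xs ≤ 5940) × (All (C u) xs × (sumSq xs ≡ + n)))
theorem2p3 u 2≤u n = squaresInC-≤ (ℕP.m≤m+n 28 5912) (Construction.every-number 2≤u n)
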